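{- Let $F$ be a CNF formula, $(T,\delta)$ a decomposition tree of $I(F)$, $z$ a node of $T$, and $s$ a proper shape for $z$. Then $s\in\mathcal{R}_z$.
   Context: A clause is a finite set of literals (variables $x$ or negations $\bar x$) not containing both $x$ and $\bar x$; a CNF formula $F$ is a finite set of clauses; $\mathrm{var}(C)$, $\mathrm{var}(F)$ denote occurring variables. The incidence graph $I(F)$ has vertex set $\mathrm{var}(F)\cup F$ and edges $Cx$ for $x\in\mathrm{var}(C)$. A decomposition tree of a graph is a pair $(T,\delta)$ with $T$ a rooted binary tree and $\delta$ a bijection from the leaves of $T$ to the vertex set. For a set of variables $X$, $2^X$ is the set of maps $\sigma:X\to\{0,1\}$ ($\sigma(\bar x)=1-\sigma(x)$); $\sigma$ satisfies $C$ if $\sigma(\ell)=1$ for some $\ell\in C$ with variable in $X$. For a set of clauses $G$, $G(\sigma)$ is the set of clauses of $G$ satisfied by $\sigma$, $\mathrm{Proj}(G,X)=\{G(\sigma):\sigma\in2^X\}$, and $G^{\supseteq X}=\{C\in G: X\subseteq\mathrm{var}(C)\}$. For a node $z$ of $T$ let $T_z$ be the subtree rooted at $z$ with leaf set $L(T_z)$; $\mathrm{var}_z=\mathrm{var}(F)\cap\delta(L(T_z))$, $F_z=F\cap\delta(L(T_z))$, $\overline{F_z}=F\setminus F_z$, $\overline{\mathrm{var}_z}=\mathrm{var}(F)\setminus\mathrm{var}_z$. A shape for $z$ is a pair $(\mathit{out},\mathit{in})$ with $\mathit{out}\subseteq\overline{F_z}$, $\mathit{in}\subseteq F_z$; it is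 proper if $\mathit{out}\in\mathrm{Proj}(\overline{F_z},\mathrm{var}_z)$ and $\mathit{in}\in\mathrm{Proj}(F_z,\overline{\mathrm{var}_z})$. Let $\mathcal{X}^{\uparrow}_z=\{X\subseteq\mathrm{var}_z:\exists C\in\overline{F_z},\ X=\mathrm{var}_z\cap\mathrm{var}(C)\}$ and $\mathcal{X}^{\downarrow}_z=\{X\subseteq\overline{\mathrm{var}_z}:\exists C\in F_z,\ X=\overline{\mathrm{var}_z}\cap\mathrm{var}(C)\}$. $\Phi_z$ is the set of functions $f$ with domain $\mathcal{X}^{\uparrow}_z$ with $f(X)\in\mathrm{Proj}(\overline{F_z}^{\supseteq X},X)$; $\Psi_z$ is the set of functions $g$ with domain $\mathcal{X}^{\downarrow}_z$ with $g(Y)\in\mathrm{Proj}(F_z^{\supseteq Y},Y)$. For such $h$, $\mathrm{union}(h)=\bigcup_{X\in\mathrm{dom}(h)}h(X)$. The set of restricted shapes is $\mathcal{R}_z=\{(\mathit{out},\mathit{in})\text{ shape for }z:\exists f\in\Phi_z,\ \mathit{out}=\mathrm{union}(f),\ \exists g\in\Psi_z,\ \mathit{in}=\mathrm{union}(g)\}$. -}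

module Defs where

open import Data.Nat using (ℕ)
open import Data.Fin using (Fin)
open import Data.Fin.Subset using (Subset; _∈_)
open import Data.Bool using (Bool)
open import Data.Maybe using (Maybe; just; is-just)
open import Data.Vec using (Vec; lookup)
import Data.Vec as Vec
open import Data.Sum using (_⊎_; inj₁; inj₂)
open import Data.Product using (Σ; ∃; ∃-syntax; _×_; _,_)
open import Data.Unit using (⊤)
open import Data.List using (List; []; _∷_; _++_)
import Data.List.Membership.Propositional as L
open import Data.List.Relation.Unary.Unique.Propositional using (Unique)
open import Relation.Nullary using (¬_)
open import Relation.Binary.PropositionalEquality using (_≡_)
open import Function.Bundles using (_⇔_)

-- A clause assigns to each variable x: nothing (x does not occur),
-- just true (the literal x occurs), just false (the literal x̄ occurs).
-- Hence a clause never contains both x and x̄.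

Clause : ℕ → Set
Clause n = Vec (Maybe Bool) n

varC : ∀ {n} → Clause n → Subset n
varC = Vec.map is-just

-- A CNF formula: a finite *set* of m clauses, given as an injective
-- enumeration Fin m → Clause n (clauses are identified with Fin m).
record CNF (n m : ℕ) : Set where
  field
    cl  : Fin m → Clause n
    inj : ∀ i j → cl i ≡ cl j → i ≡ j
open CNF public

module _ {n m : ℕ} (F : CNF n m) where

  VarF : Fin n → Set
  VarF x = ∃[ C ] x ∈ varC (cl F C)

-- Incidence graph vertices: inj₁ x (variable) or inj₂ C (clause).

Vertex : ℕ → ℕ → Set
Vertex n m = Fin n ⊎ Fin m

IsVertex : ∀ {n m} → CNF n m → Vertex n m → Set
IsVertex F (inj₁ x) = VarF F x
IsVertex F (inj₂ C) = ⊤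

-- Rooted binary trees (every node has at most two children), leaves
-- labelled by δ.

data BTree (A : Set) : Set where
  leaf  : A → BTree A
  node₁ : BTree A → BTree A
  node₂ : BTree A → BTree A → BTree A

leaves : ∀ {A} → BTree A → List A
leaves (leaf a)      = a ∷ []
leaves (node₁ t)     = leaves t
leaves (node₂ t u)   = leaves t ++ leaves u

-- z ≼ T : z is the subtree T_z rooted at some node of T
data _≼_ {A : Set} : BTree A → BTree A → Set where
  here : ∀ {t} → t ≼ t
  in₁  : ∀ {t u} → t ≼ u → t ≼ node₁ u
  inˡ  : ∀ {t u v} → t ≼ u → t ≼ node₂ u v
  inʳ  : ∀ {t u v} → t ≼ v → t ≼ node₂ u v

-- (T, δ) is a decomposition tree of I(F): δ (the leaf labelling) is a
-- bijection from the leaves of T onto var(F) ∪ F.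
IsDecompTree : ∀ {n m} → CNF n m → BTree (Vertex n m) → Set
IsDecompTree F T = Unique (leaves T) × (∀ v → (v L.∈ leaves T) ⇔ IsVertex F v)

module _ {n m : ℕ} (F : CNF n m) where

  -- σ ∈ 2^X (given as a total map, only values on X matter) satisfies C
  Sat : (Fin n → Bool) → (Fin n → Set) → Fin m → Set
  Sat σ X C = ∃[ x ] (X x × lookup (cl F C) x ≡ just (σ x))

  InProj : (G : Fin m → Set) (X : Fin n → Set) → Subset m → Set
  InProj G X S = ∃[ σ ] (∀ C → (C ∈ S) ⇔ (G C × Sat σ X C))

  Sup : (G : Fin m → Set) (X : Fin n → Set) → Fin m → Set
  Sup G X C = G C × (∀ x → X x → x ∈ varC (cl F C))

  module _ (z : BTree (Vertex n m)) where

    Varz : Fin n → Set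
    Varz x = inj₁ x L.∈ leaves z

    Fz : Fin m → Set
    Fz C = inj₂ C L.∈ leaves z

    coVarz : Fin n → Set
    coVarz x = VarF F x × ¬ Varz x

    coFz : Fin m → Set
    coFz C = ¬ Fz C

    IsShape : Subset m → Subset m → Set
    IsShape out inn = (∀ C → C ∈ out → coFz C) × (∀ C → C ∈ inn → Fz C)

    IsProperShape : Subset m → Subset m → Set
    IsProperShape out inn =
      IsShape out inn × InProj coFz Varz out × InProj Fz coVarz inn

    XUp : Subset n → Set
    XUp X = ∃[ C ] (coFz C × (∀ x → (x ∈ X) ⇔ (Varz x × x ∈ varC (cl F C))))

    XDown : Subset n → Set
    XDown Y = ∃[ C ] (Fz C × (∀ x → (x ∈ Y) ⇔ (coVarz x × x ∈ varC (cl F C))))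

    -- f ∈ Φ_z (values outside the domain 𝒳↑_z are irrelevant)
    InΦ : (Subset n → Subset m) → Set
    InΦ f = ∀ X → XUp X → InProj (Sup coFz (_∈ X)) (_∈ X) (f X)

    InΨ : (Subset n → Subset m) → Set
    InΨ g = ∀ Y → XDown Y → InProj (Sup Fz (_∈ Y)) (_∈ Y) (g Y)

    IsUnion : (D : Subset n → Set) (h : Subset n → Subset m) → Subset m → Set
    IsUnion D h S = ∀ C → (C ∈ S) ⇔ (∃[ X ] (D X × C ∈ h X))

    InR : Subset m → Subset m → Set
    InR out inn =
      IsShape out inn
      × (∃[ f ] (InΦ f × IsUnion XUp f out))
      × (∃[ g ] (InΨ g × IsUnion XDown g inn))

-- If out = Ḡ(σ) for Ḡ = F ∖ F_z and σ on var_z, put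
-- f(X) = {C ∈ out : X ⊆ var(C), σ satisfies C on X} for X ∈ 𝒳↑_z. As X is
-- contained in var_z, a clause of Ḡ^{⊇X} satisfied on X is satisfied on var_z,
-- so f(X) = Ḡ^{⊇X}(σ) ∈ Proj(Ḡ^{⊇X}, X); and every C ∈ out lies in f(X) for
-- X = var_z ∩ var(C). Hence out = union(f). The argument for `in' is the same
-- with F_z and var(F) ∖ var_z, and nothing about the tree is used.
module Submission where

open import Defs
open import Level using (0ℓ)
open import Data.Nat using (ℕ)
open import Data.Bool using (Bool; true)
import Data.Bool.Properties as Bool
open import Data.Fin using (Fin)
open import Data.Fin.Subset using (Subset; _∈_)
open import Data.Fin.Subset.Properties using (_∈?_)
open import Data.Maybe using (just; is-just)
import Data.Maybe.Properties as Maybe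
open import Data.Product using (∃-syntax; _×_; _,_; proj₁; proj₂)
open import Data.Sum using (inj₁)
import Data.Sum.Properties as Sum
open import Data.Fin.Properties using (any?; all?)
import Data.Fin.Properties as Fin
open import Data.Vec using (lookup; tabulate)
open import Data.Vec.Properties using (lookup∘tabulate; lookup⇒[]=; []=⇒lookup; lookup-map)
import Data.List.Membership.DecPropositional as ListMembership
open import Function using (_∘_)
open import Function.Bundles using (_⇔_; mk⇔; Equivalence)
open import Relation.Nullary using (Dec; yes; does; ¬?; _×-dec_; _→-dec_)
open import Relation.Nullary.Decidable using (dec-true)
open import Relation.Unary using (Pred; Decidable)
open import Relation.Binary.PropositionalEquality using (_≡_; sym; trans; cong)

open Equivalence

does-true⇒ : ∀ {A : Set} (a? : Dec A) → does a? ≡ true → A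
does-true⇒ (yes a) _ = a

toSubset : ∀ {k} {P : Pred (Fin k) 0ℓ} → Decidable P → Subset k
toSubset P? = tabulate (does ∘ P?)

∈-toSubset : ∀ {k} {P : Pred (Fin k) 0ℓ} (P? : Decidable P) x → (x ∈ toSubset P?) ⇔ P x
∈-toSubset P? x = mk⇔
  (λ x∈ → does-true⇒ (P? x) (trans (sym (lookup∘tabulate _ x)) ([]=⇒lookup x∈)))
  (λ Px → lookup⇒[]= x _ (trans (lookup∘tabulate _ x) (dec-true (P? x) Px)))

module _ {n m : ℕ} (F : CNF n m) where

  ∈-varC : ∀ {C x b} → lookup (cl F C) x ≡ just b → x ∈ varC (cl F C)
  ∈-varC {C} {x} eq = lookup⇒[]= x _ (trans (lookup-map x is-just (cl F C)) (cong is-just eq))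

  Sat? : ∀ σ (X : Subset n) → Decidable (Sat F σ (_∈ X))
  Sat? σ X C = any? λ x → x ∈? X ×-dec Maybe.≡-dec Bool._≟_ (lookup (cl F C) x) (just (σ x))

  Covers : Subset n → Pred (Fin m) 0ℓ
  Covers X C = ∀ x → x ∈ X → x ∈ varC (cl F C)

  Covers? : ∀ X → Decidable (Covers X)
  Covers? X C = all? λ x → x ∈? X →-dec x ∈? varC (cl F C)

  Sat-mono : ∀ {σ} {X Y : Pred (Fin n) 0ℓ} {C} → (∀ x → X x → Y x) → Sat F σ X C → Sat F σ Y C
  Sat-mono X⊆Y (x , Xx , eq) = x , X⊆Y x Xx , eq

  -- 𝒳↑_z and 𝒳↓_z are the cases (G, P) = (F ∖ F_z, var_z) and (F_z, var(F) ∖ var_z).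
  IsTrace : Pred (Fin m) 0ℓ → Pred (Fin n) 0ℓ → Subset n → Set
  IsTrace G P X = ∃[ C ] (G C × (∀ x → (x ∈ X) ⇔ (P x × x ∈ varC (cl F C))))

  module Restriction (G : Pred (Fin m) 0ℓ) {P : Pred (Fin n) 0ℓ} (P? : Decidable P)
           {S : Subset m} (σ : Fin n → Bool) (S≡G[σ] : ∀ C → (C ∈ S) ⇔ (G C × Sat F σ P C)) where

    Restricted? : ∀ X → Decidable λ C → C ∈ S × Sat F σ (_∈ X) C × Covers X C
    Restricted? X C = C ∈? S ×-dec (Sat? σ X C ×-dec Covers? X C)

    restrict : Subset n → Subset m
    restrict X = toSubset (Restricted? X)

    restrict∈Proj : ∀ X → IsTrace G P X → InProj F (Sup F G (_∈ X)) (_∈ X) (restrict X)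
    restrict∈Proj X (_ , _ , X≡P∩C₀) = σ , λ C → mk⇔
      (λ C∈ → let C∈S , sat , cov = to (∈-toSubset (Restricted? X) C) C∈
              in (proj₁ (to (S≡G[σ] C) C∈S) , cov) , sat)
      (λ ((GC , cov) , sat) → from (∈-toSubset (Restricted? X) C)
        (from (S≡G[σ] C) (GC , Sat-mono (λ x → proj₁ ∘ to (X≡P∩C₀ x)) sat) , sat , cov))

    InTrace? : ∀ C → Decidable λ x → P x × x ∈ varC (cl F C)
    InTrace? C x = P? x ×-dec x ∈? varC (cl F C)

    trace : Fin m → Subset n
    trace C = toSubset (InTrace? C)

    trace-isTrace : ∀ {C} → G C → IsTrace G P (trace C)
    trace-isTrace {C} GC = C , GC , ∈-toSubset (InTrace? C)

    ∈-restrict-trace : ∀ {C} → C ∈ S → C ∈ restrict (trace C)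
    ∈-restrict-trace {C} C∈S with to (S≡G[σ] C) C∈S
    ... | _ , (x , Px , eq) = from (∈-toSubset (Restricted? (trace C)) C)
      (C∈S , (x , from (∈-toSubset (InTrace? C) x) (Px , ∈-varC eq) , eq)
           , λ y → proj₂ ∘ to (∈-toSubset (InTrace? C) y))

  Proj-decomposes : (G : Pred (Fin m) 0ℓ) {P : Pred (Fin n) 0ℓ} → Decidable P → ∀ {S} → InProj F G P S →
    ∃[ h ] ((∀ X → IsTrace G P X → InProj F (Sup F G (_∈ X)) (_∈ X) (h X))
           × (∀ C → (C ∈ S) ⇔ (∃[ X ] (IsTrace G P X × C ∈ h X))))
  Proj-decomposes G P? (σ , S≡G[σ]) = restrict , restrict∈Proj , λ C → mk⇔
    (λ C∈S → trace C , trace-isTrace (proj₁ (to (S≡G[σ] C) C∈S)) , ∈-restrict-trace C∈S)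
    (λ (X , _ , C∈) → proj₁ (to (∈-toSubset (Restricted? X) C) C∈))
    where open Restriction G P? σ S≡G[σ]

  VarF? : Decidable (VarF F)
  VarF? x = any? λ C → x ∈? varC (cl F C)

  module _ (z : BTree (Vertex n m)) where
    open ListMembership (Sum.≡-dec (Fin._≟_ {n}) (Fin._≟_ {m})) using () renaming (_∈?_ to _∈ₗ?_)

    Varz? : Decidable (Varz F z)
    Varz? x = inj₁ x ∈ₗ? leaves z

    coVarz? : Decidable (coVarz F z)
    coVarz? x = VarF? x ×-dec ¬? (Varz? x)

lemma8 : ∀ {n m : ℕ} (F : CNF n m) (T : BTree (Vertex n m)) → IsDecompTree F T →
    ∀ (z : BTree (Vertex n m)) → z ≼ T →
    ∀ (out inn : Subset m) → IsProperShape F z out inn → InR F z out inn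
lemma8 F _ _ z _ _ _ (shape , out∈Proj , inn∈Proj) =
  shape , Proj-decomposes F (coFz F z) (Varz? F z) out∈Proj
        , Proj-decomposes F (Fz F z) (coVarz? F z) inn∈Proj
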